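{- Let $n_0\ge 1$ and $n_1\ge 3$ be integers, and let $H=H(u;n_0,n_1)$ be the tree with bipartition $(B_0,B_1)$, $|B_0|=n_0$, $|B_1|=n_1$, containing a node $u\in B_0$ whose neighborhood is exactly $B_1$, and such that every node $w\in B_1$ has degree $\deg_H(w)\in\left\{1+\left\lceil \frac{n_0-1}{n_1}\right\rceil,\ 1+\left\lfloor \frac{n_0-1}{n_1}\right\rfloor\right\}$. Then \[ C_1(u;H)\ \ge\ \frac{n_1-1}{2(2n_1-1)}. \]
   Context: For a connected graph $G$ and a node $v$, let $\mathrm{dist}_G(v,x)$ denote the length of a shortest $v$–$x$ path, $W_G(v)=\sum_{x\in V(G)}\mathrm{dist}_G(v,x)$, and the closeness of $v$ is $C_G(v)=1/W_G(v)$. The closeness centralization of $v$ in $G$ is $C_1(v;G)=\sum_{x\in V(G)}\big[C_G(v)-C_G(x)\big]$. -}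

module Defs where

open import Data.Nat using (ℕ; zero; suc; _+_; _≤_)
open import Data.Nat.DivMod using (_/_)
open import Data.Integer using (+_)
open import Data.Fin using (Fin)
import Data.Fin as F
open import Data.Bool using (Bool; true; false; if_then_else_)
open import Data.List using (List; []; _∷_)
open import Data.List.Relation.Unary.Unique.Propositional using (Unique)
open import Data.Product using (Σ; ∃; _×_)
open import Data.Empty using (⊥)
open import Relation.Binary.PropositionalEquality using (_≡_)
open import Data.Rational using (ℚ; 0ℚ; _-_) renaming (_+_ to _+ℚ_; _*_ to _*ℚ_)
import Data.Rational as Q

sumℕ : {n : ℕ} → (Fin n → ℕ) → ℕ
sumℕ {zero}  f = 0
sumℕ {suc n} f = f F.zero + sumℕ (λ i → f (F.suc i))

sumℚ : {n : ℕ} → (Fin n → ℚ) → ℚ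
sumℚ {zero}  f = 0ℚ
sumℚ {suc n} f = f F.zero +ℚ sumℚ (λ i → f (F.suc i))

count : {n : ℕ} → (Fin n → Bool) → ℕ
count p = sumℕ (λ i → if p i then 1 else 0)

-- floor and ceiling of m / n (value 0 for n = 0; never used there)
floorDiv : ℕ → ℕ → ℕ
floorDiv m zero    = 0
floorDiv m (suc n) = m / suc n

ceilDiv : ℕ → ℕ → ℕ
ceilDiv m zero    = 0
ceilDiv m (suc n) = (m + n) / suc n

-- the rational number m / n (value 0 for n = 0; never used there)
frac : ℕ → ℕ → ℚ
frac m zero    = 0ℚ
frac m (suc n) = (+ m) Q./ suc n

record Graph (n : ℕ) : Set where
  field
    adj   : Fin n → Fin n → Bool
    sym   : ∀ x y → adj x y ≡ adj y x
    irref : ∀ x → adj x x ≡ false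
open Graph public

deg : {n : ℕ} → Graph n → Fin n → ℕ
deg G v = count (adj G v)

data Walk {n : ℕ} (G : Graph n) : Fin n → Fin n → ℕ → Set where
  nil  : ∀ {v} → Walk G v v 0
  cons : ∀ {v y x k} → adj G v y ≡ true → Walk G y x k → Walk G v x (suc k)

verts : ∀ {n} {G : Graph n} {v x k} → Walk G v x k → List (Fin n)
verts {v = v} nil        = v ∷ []
verts {v = v} (cons e w) = v ∷ verts w

Connected : {n : ℕ} → Graph n → Set
Connected G = ∀ v x → ∃ λ k → Walk G v x k

-- a cycle: a path y … x with distinct vertices and at least 3 vertices, closed by the edge x y
HasCycle : {n : ℕ} → Graph n → Set
HasCycle {n} G = Σ (Fin n) λ x → Σ (Fin n) λ y → Σ ℕ λ k →
  Σ (Walk G y x k) λ w → (2 ≤ k) × adj G x y ≡ true × Unique (verts w)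

IsTree : {n : ℕ} → Graph n → Set
IsTree G = Connected G × (HasCycle G → ⊥)

IsDist : {n : ℕ} → Graph n → (Fin n → Fin n → ℕ) → Set
IsDist G dist = (∀ v x → Walk G v x (dist v x)) × (∀ v x k → Walk G v x k → dist v x ≤ k)

-- W(v), closeness C(v) = 1 / W(v) (W(v) ≥ 1 whenever there are ≥ 2 vertices)
W : {n : ℕ} → (Fin n → Fin n → ℕ) → Fin n → ℕ
W dist v = sumℕ (dist v)

closeness : {n : ℕ} → (Fin n → Fin n → ℕ) → Fin n → ℚ
closeness dist v = frac 1 (W dist v)

C1 : {n : ℕ} → (Fin n → Fin n → ℕ) → Fin n → ℚ
C1 dist v = sumℚ (λ x → closeness dist v - closeness dist x)

-- In H every leaf (node of B₀ other than u) hangs from exactly one hub (node of B₁), so with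
-- m = n₀ − 1 and f = ⌊m / n₁⌋ all distance sums are determined: W(u) = n₁ + 2m, a hub with
-- k ∈ {f, f + 1} leaves has W = 2n₁ − 1 + 3m − 2k, and each of its leaves has W = 3n₁ − 2 + 4m − 2k
-- (only W(u) ≤ and W(x) ≥ these values are used).  Since 1/W(u) − 1/W(x) = (W(x) − W(u)) / (W(u) W(x)),
-- enlarging W(x) in the denominator to its value for k = f puts every term of C₁(u; H) over one
-- common denominator.  The resulting polynomial inequality in n₁ − 3, f and the number of hubs with
-- f + 1 leaves holds coefficientwise once one variable is eliminated through the number of hubs.
module Submission where

open import Data.Nat as ℕ using (ℕ; zero; suc; _+_; _*_; _∸_; _≤_; _<_; _≤ᵇ_; z≤n; s≤s)
import Data.Nat.Properties as ℕ
open import Algebra.Properties.CommutativeSemigroup ℕ.+-commutativeSemigroup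
  using () renaming (interchange to +-interchange)
open import Data.Nat.DivMod using (_/_; /-monoˡ-≤; m/n≡1+[m∸n]/n; m*n/n≡m)
import Data.Nat.Tactic.RingSolver as ℕ-Solver
import Data.Integer as ℤ
import Data.Integer.Properties as ℤ
import Data.Integer.Tactic.RingSolver as ℤ-Solver
open import Data.Rational as Q using (ℚ; 0ℚ; fromℚᵘ; toℚᵘ)
import Data.Rational.Properties as Q
open import Data.Rational.Unnormalised as Qᵘ using (mkℚᵘ; *≡*; *≤*)
import Data.Rational.Unnormalised.Properties as Qᵘ
open import Data.Fin using (Fin) renaming (zero to fzero; suc to fsuc)
open import Data.Fin.Properties using (_≟_; suc-injective)
open import Data.Bool using (Bool; true; false; not; _∧_; if_then_else_; T)
open import Data.Bool.Properties using (T-∧; ¬-not; not-¬)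
open import Data.List using (List; []; _∷_; map)
open import Data.List.Relation.Unary.All using ([]; _∷_)
open import Data.List.Relation.Unary.AllPairs using ([]; _∷_)
open import Data.Vec using (Vec; []; _∷_; lookup)
open import Data.Product using (_×_; _,_; proj₁; proj₂; ∃)
open import Data.Sum using (_⊎_; inj₁; inj₂)
open import Data.Empty using (⊥; ⊥-elim)
open import Function using (_∘_)
open import Function.Bundles using (_⇔_; Equivalence)
open import Relation.Nullary using (¬_; Dec; yes; no; does; contradiction)
open import Relation.Binary.PropositionalEquality
  using (_≡_; _≢_; refl; sym; trans; cong; cong₂; subst; subst₂; module ≡-Reasoning)
open import Defs hiding (sym)

[_] : Bool → ℕ
[ b ] = if b then 1 else 0

sumℕ-cong : ∀ {n} {f g : Fin n → ℕ} → (∀ i → f i ≡ g i) → sumℕ f ≡ sumℕ g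
sumℕ-cong {zero}  f≡g = refl
sumℕ-cong {suc n} f≡g = cong₂ _+_ (f≡g fzero) (sumℕ-cong (f≡g ∘ fsuc))

sumℕ-0 : ∀ {n} {f : Fin n → ℕ} → (∀ i → f i ≡ 0) → sumℕ f ≡ 0
sumℕ-0 {zero}  f≡0 = refl
sumℕ-0 {suc n} f≡0 = cong₂ _+_ (f≡0 fzero) (sumℕ-0 (f≡0 ∘ fsuc))

sumℕ-+ : ∀ {n} (f g : Fin n → ℕ) → sumℕ (λ i → f i + g i) ≡ sumℕ f + sumℕ g
sumℕ-+ {zero}  f g = refl
sumℕ-+ {suc n} f g = begin
  f fzero + g fzero + sumℕ (λ i → f (fsuc i) + g (fsuc i))
    ≡⟨ cong ((f fzero + g fzero) +_) (sumℕ-+ (f ∘ fsuc) (g ∘ fsuc)) ⟩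
  f fzero + g fzero + (sumℕ (f ∘ fsuc) + sumℕ (g ∘ fsuc))
    ≡⟨ +-interchange (f fzero) (g fzero) _ _ ⟩
  f fzero + sumℕ (f ∘ fsuc) + (g fzero + sumℕ (g ∘ fsuc))
    ∎
  where open ≡-Reasoning

sumℕ-*ˡ : ∀ {n} k (f : Fin n → ℕ) → sumℕ (λ i → k * f i) ≡ k * sumℕ f
sumℕ-*ˡ {zero}  k f = sym (ℕ.*-zeroʳ k)
sumℕ-*ˡ {suc n} k f =
  trans (cong (k * f fzero +_) (sumℕ-*ˡ k (f ∘ fsuc))) (sym (ℕ.*-distribˡ-+ k (f fzero) _))

sumℕ-*ʳ : ∀ {n} k (f : Fin n → ℕ) → sumℕ (λ i → f i * k) ≡ sumℕ f * k
sumℕ-*ʳ k f = trans (sumℕ-cong (λ i → ℕ.*-comm (f i) k)) (trans (sumℕ-*ˡ k f) (ℕ.*-comm k _))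

sumℕ-linear : ∀ {n} (f g : Fin n → ℕ) k → sumℕ (λ i → f i + k * g i) ≡ sumℕ f + k * sumℕ g
sumℕ-linear f g k = trans (sumℕ-+ f (λ i → k * g i)) (cong (sumℕ f +_) (sumℕ-*ˡ k g))

sumℕ-combination : ∀ {n} a (f : Fin n → ℕ) b (g : Fin n → ℕ) →
                   sumℕ (λ i → a * f i + b * g i) ≡ a * sumℕ f + b * sumℕ g
sumℕ-combination a f b g =
  trans (sumℕ-+ (λ i → a * f i) (λ i → b * g i)) (cong₂ _+_ (sumℕ-*ˡ a f) (sumℕ-*ˡ b g))

sumℕ-mono-≤ : ∀ {n} {f g : Fin n → ℕ} → (∀ i → f i ≤ g i) → sumℕ f ≤ sumℕ g
sumℕ-mono-≤ {zero}  f≤g = z≤n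
sumℕ-mono-≤ {suc n} f≤g = ℕ.+-mono-≤ (f≤g fzero) (sumℕ-mono-≤ (f≤g ∘ fsuc))

sumℕ-comm : ∀ {m n} (f : Fin m → Fin n → ℕ) →
            sumℕ (λ i → sumℕ (f i)) ≡ sumℕ (λ j → sumℕ (λ i → f i j))
sumℕ-comm {zero} {n} f = sym (sumℕ-0 {n} (λ _ → refl))
sumℕ-comm {suc m} f =
  trans (cong (sumℕ (f fzero) +_) (sumℕ-comm (f ∘ fsuc))) (sym (sumℕ-+ (f fzero) _))

sumℕ-single : ∀ {n} (f : Fin n → ℕ) j → (∀ i → i ≢ j → f i ≡ 0) → sumℕ f ≡ f j
sumℕ-single f fzero    f≡0 =
  trans (cong (f fzero +_) (sumℕ-0 (λ i → f≡0 (fsuc i) λ ()))) (ℕ.+-identityʳ _)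
sumℕ-single f (fsuc j) f≡0 =
  cong₂ _+_ (f≡0 fzero λ ()) (sumℕ-single (f ∘ fsuc) j (λ i i≢j → f≡0 (fsuc i) (i≢j ∘ suc-injective)))

sumℚ-mono-≤ : ∀ {n} {f g : Fin n → ℚ} → (∀ i → f i Q.≤ g i) → sumℚ f Q.≤ sumℚ g
sumℚ-mono-≤ {zero}  f≤g = Q.≤-refl
sumℚ-mono-≤ {suc n} f≤g = Q.+-mono-≤ (f≤g fzero) (sumℚ-mono-≤ (f≤g ∘ fsuc))

_==_ : ∀ {n} → Fin n → Fin n → Bool
i == j = does (i ≟ j)

count-== : ∀ {n} (j : Fin n) → count (_== j) ≡ 1
count-== j = trans (sumℕ-single _ j off) on
  where
  off : ∀ i → i ≢ j → [ i == j ] ≡ 0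
  off i i≢j with i ≟ j
  ... | yes i≡j = contradiction i≡j i≢j
  ... | no  _   = refl
  on : [ j == j ] ≡ 1
  on with j ≟ j
  ... | yes _   = refl
  ... | no  j≢j = contradiction refl j≢j

fromℚᵘ-homo-+ : ∀ p q → fromℚᵘ (p Qᵘ.+ q) ≡ fromℚᵘ p Q.+ fromℚᵘ q
fromℚᵘ-homo-+ p q = Q.toℚᵘ-injective (begin-equality
  toℚᵘ (fromℚᵘ (p Qᵘ.+ q))                ≃⟨ Q.toℚᵘ-fromℚᵘ (p Qᵘ.+ q) ⟩
  p Qᵘ.+ q                                 ≃⟨ Qᵘ.+-cong (Q.toℚᵘ-fromℚᵘ p) (Q.toℚᵘ-fromℚᵘ q) ⟨
  toℚᵘ (fromℚᵘ p) Qᵘ.+ toℚᵘ (fromℚᵘ q)    ≃⟨ Q.toℚᵘ-homo-+ (fromℚᵘ p) (fromℚᵘ q) ⟨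
  toℚᵘ (fromℚᵘ p Q.+ fromℚᵘ q)            ∎)
  where open Qᵘ.≤-Reasoning

fromℚᵘ-homo‿- : ∀ p → fromℚᵘ (Qᵘ.- p) ≡ Q.- fromℚᵘ p
fromℚᵘ-homo‿- p = Q.toℚᵘ-injective (begin-equality
  toℚᵘ (fromℚᵘ (Qᵘ.- p))    ≃⟨ Q.toℚᵘ-fromℚᵘ (Qᵘ.- p) ⟩
  Qᵘ.- p                    ≃⟨ Qᵘ.-‿cong (Q.toℚᵘ-fromℚᵘ p) ⟨
  Qᵘ.- toℚᵘ (fromℚᵘ p)      ≃⟨ Q.toℚᵘ-homo‿- (fromℚᵘ p) ⟨
  toℚᵘ (Q.- fromℚᵘ p)       ∎)
  where open Qᵘ.≤-Reasoning

fromℚᵘ-mono-≤ : ∀ {p q} → p Qᵘ.≤ q → fromℚᵘ p Q.≤ fromℚᵘ q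
fromℚᵘ-mono-≤ {p} {q} p≤q = Q.toℚᵘ-cancel-≤ (begin
  toℚᵘ (fromℚᵘ p) ≃⟨ Q.toℚᵘ-fromℚᵘ p ⟩
  p               ≤⟨ p≤q ⟩
  q               ≃⟨ Q.toℚᵘ-fromℚᵘ q ⟨
  toℚᵘ (fromℚᵘ q) ∎)
  where open Qᵘ.≤-Reasoning

frac-≤ : ∀ {a b c d} → 0 < b → 0 < d → a * d ≤ c * b → frac a b Q.≤ frac c d
frac-≤ {a} {suc b} {c} {suc d} _ _ ad≤cb =
  fromℚᵘ-mono-≤ {mkℚᵘ (ℤ.+ a) b} {mkℚᵘ (ℤ.+ c) d}
    (*≤* (subst₂ ℤ._≤_ (ℤ.pos-* a (suc d)) (ℤ.pos-* c (suc b)) (ℤ.+≤+ ad≤cb)))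

frac-zero : ∀ {d} → 0 < d → frac 0 d ≡ 0ℚ
frac-zero {suc d} _ = Q.fromℚᵘ-cong {mkℚᵘ (ℤ.+ 0) d} {mkℚᵘ (ℤ.+ 0) 0} (*≡* refl)

frac-+ : ∀ a b {d} → 0 < d → frac a d Q.+ frac b d ≡ frac (a + b) d
frac-+ a b {suc d} _ =
  trans (sym (fromℚᵘ-homo-+ (mkℚᵘ (ℤ.+ a) d) (mkℚᵘ (ℤ.+ b) d)))
        (Q.fromℚᵘ-cong {mkℚᵘ (ℤ.+ a) d Qᵘ.+ mkℚᵘ (ℤ.+ b) d} {mkℚᵘ (ℤ.+ (a + b)) d} (*≡* cross))
  where
  cross : (ℤ.+ a ℤ.* ℤ.+[1+ d ] ℤ.+ ℤ.+ b ℤ.* ℤ.+[1+ d ]) ℤ.* ℤ.+[1+ d ] ≡ ℤ.+ (a + b) ℤ.* ℤ.+ (suc d * suc d)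
  cross rewrite ℤ.pos-+ a b | ℤ.pos-* (suc d) (suc d) = distrib (ℤ.+ a) (ℤ.+ b) ℤ.+[1+ d ]
    where
    distrib : ∀ a b e → (a ℤ.* e ℤ.+ b ℤ.* e) ℤ.* e ≡ (a ℤ.+ b) ℤ.* (e ℤ.* e)
    distrib = ℤ-Solver.solve-∀

sumℚ-frac : ∀ {n d} → 0 < d → (g : Fin n → ℕ) → sumℚ (λ i → frac (g i) d) ≡ frac (sumℕ g) d
sumℚ-frac {zero}  0<d g = sym (frac-zero 0<d)
sumℚ-frac {suc n} {d} 0<d g =
  trans (cong (frac (g fzero) d Q.+_) (sumℚ-frac 0<d (λ i → g (fsuc i)))) (frac-+ (g fzero) _ 0<d)

reciprocal-difference : ∀ {a} d → 0 < a → frac 1 a Q.- frac 1 (a + d) ≡ frac d (a * (a + d))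
reciprocal-difference {suc a} d _ =
  trans (cong (frac 1 (suc a) Q.+_) (sym (fromℚᵘ-homo‿- (mkℚᵘ (ℤ.+ 1) (a + d)))))
        (trans (sym (fromℚᵘ-homo-+ (mkℚᵘ (ℤ.+ 1) a) (Qᵘ.- mkℚᵘ (ℤ.+ 1) (a + d))))
               (Q.fromℚᵘ-cong {mkℚᵘ (ℤ.+ 1) a Qᵘ.- mkℚᵘ (ℤ.+ 1) (a + d)} {mkℚᵘ (ℤ.+ d) (a + d + a * suc (a + d))}
                              (*≡* (cong (ℤ._* ℤ.+ (suc a * suc (a + d))) cross-numerator))))
  where
  cross-numerator : ℤ.+ 1 ℤ.* ℤ.+[1+ (a + d) ] ℤ.+ ℤ.- ℤ.+ 1 ℤ.* ℤ.+[1+ a ] ≡ ℤ.+ d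
  cross-numerator rewrite ℤ.pos-+ 1 (a + d) | ℤ.pos-+ a d | ℤ.pos-+ 1 a = cancel (ℤ.+ a) (ℤ.+ d)
    where
    cancel : ∀ a d → ℤ.+ 1 ℤ.* (ℤ.+ 1 ℤ.+ (a ℤ.+ d)) ℤ.+ ℤ.- ℤ.+ 1 ℤ.* (ℤ.+ 1 ℤ.+ a) ≡ d
    cancel = ℤ-Solver.solve-∀

reciprocal-antitone : ∀ {a b} → 0 < a → a ≤ b → frac 1 b Q.≤ frac 1 a
reciprocal-antitone 0<a a≤b = frac-≤ (ℕ.<-≤-trans 0<a a≤b) 0<a (ℕ.*-monoʳ-≤ 1 a≤b)

reciprocal-gap : ∀ {W₁ W₂ a} d → 0 < W₁ → W₁ ≤ a → a + d ≤ W₂ →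
  frac d (a * (a + d)) Q.≤ frac 1 W₁ Q.- frac 1 W₂
reciprocal-gap {W₁} {W₂} {a} d 0<W₁ W₁≤a a+d≤W₂ = begin
  frac d (a * (a + d))            ≡⟨ reciprocal-difference d 0<a ⟨
  frac 1 a Q.- frac 1 (a + d)     ≤⟨ Q.+-mono-≤ (reciprocal-antitone 0<W₁ W₁≤a)
                                      (Q.neg-antimono-≤ (reciprocal-antitone 0<a+d a+d≤W₂)) ⟩
  frac 1 W₁ Q.- frac 1 W₂         ∎
  where
  open Q.≤-Reasoning
  0<a : 0 < a
  0<a = ℕ.<-≤-trans 0<W₁ W₁≤a
  0<a+d : 0 < a + d
  0<a+d = ℕ.<-≤-trans 0<a (ℕ.m≤m+n a d)

closeness-gap : ∀ {W₁ W₂ a Y M} d X → 0 < W₁ → W₁ ≤ a → a + d ≤ W₂ → a + d ≤ Y → M ≡ a * Y * X → 0 < X →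
  frac (d * X) M Q.≤ frac 1 W₁ Q.- frac 1 W₂
closeness-gap {W₁} {W₂} {a} {Y} d X 0<W₁ W₁≤a a+d≤W₂ a+d≤Y refl 0<X =
  Q.≤-trans (frac-≤ {d * X} {a * Y * X} {d} {a * (a + d)}
                    (ℕ.*-mono-< (ℕ.*-mono-< 0<a 0<Y) 0<X) (ℕ.*-mono-< 0<a 0<a+d) cross)
            (reciprocal-gap d 0<W₁ W₁≤a a+d≤W₂)
  where
  0<a : 0 < a
  0<a = ℕ.<-≤-trans 0<W₁ W₁≤a
  0<a+d : 0 < a + d
  0<a+d = ℕ.<-≤-trans 0<a (ℕ.m≤m+n a d)
  0<Y : 0 < Y
  0<Y = ℕ.<-≤-trans 0<a+d a+d≤Y
  rearrange : ∀ d X a e → d * X * (a * e) ≡ d * a * X * e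
  rearrange = ℕ-Solver.solve-∀
  regroup : ∀ d X a Y → d * a * X * Y ≡ d * (a * Y * X)
  regroup = ℕ-Solver.solve-∀
  cross : d * X * (a * (a + d)) ≤ d * (a * Y * X)
  cross = begin
    d * X * (a * (a + d)) ≡⟨ rearrange d X a (a + d) ⟩
    d * a * X * (a + d)   ≤⟨ ℕ.*-monoʳ-≤ (d * a * X) a+d≤Y ⟩
    d * a * X * Y         ≡⟨ regroup d X a Y ⟩
    d * (a * Y * X)       ∎
    where open ℕ.≤-Reasoning

Poly : ℕ → Set
Poly zero    = ℕ
Poly (suc k) = List (Poly k)

⟦_⟧ᴾ : ∀ {k} → Poly k → Vec ℕ k → ℕ
⟦_⟧ᴾ {zero}  a       []      = a
⟦_⟧ᴾ {suc k} []      (x ∷ ρ) = 0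
⟦_⟧ᴾ {suc k} (a ∷ p) (x ∷ ρ) = ⟦ a ⟧ᴾ ρ + x * ⟦ p ⟧ᴾ (x ∷ ρ)

0ᴾ : ∀ {k} → Poly k
0ᴾ {zero}  = 0
0ᴾ {suc k} = []

constᴾ : ∀ {k} → ℕ → Poly k
constᴾ {zero}  c = c
constᴾ {suc k} c = constᴾ c ∷ []

varᴾ : ∀ {k} → Fin k → Poly k
varᴾ {suc k} fzero    = 0ᴾ ∷ constᴾ 1 ∷ []
varᴾ {suc k} (fsuc i) = varᴾ i ∷ []

_+ᴾ_ : ∀ {k} → Poly k → Poly k → Poly k
_+ᴾ_ {zero}  a       b       = a + b
_+ᴾ_ {suc k} []      q       = q
_+ᴾ_ {suc k} (a ∷ p) []      = a ∷ p
_+ᴾ_ {suc k} (a ∷ p) (b ∷ q) = (a +ᴾ b) ∷ (p +ᴾ q)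

_*ᴾ_ : ∀ {k} → Poly k → Poly k → Poly k
_*ᴾ_ {zero}  a       b = a * b
_*ᴾ_ {suc k} []      q = []
_*ᴾ_ {suc k} (a ∷ p) q = map (a *ᴾ_) q +ᴾ (0ᴾ ∷ (p *ᴾ q))

-- Coefficientwise comparison: it implies the pointwise inequality on ℕ, which is how the polynomial
-- inequalities below are decided (the ring solvers only prove equations).
_≤ᴾ_ : ∀ {k} → Poly k → Poly k → Bool
_≤ᴾ_ {zero}  a       b       = a ≤ᵇ b
_≤ᴾ_ {suc k} []      q       = true
_≤ᴾ_ {suc k} (a ∷ p) []      = (a ≤ᴾ 0ᴾ) ∧ (p ≤ᴾ [])
_≤ᴾ_ {suc k} (a ∷ p) (b ∷ q) = (a ≤ᴾ b) ∧ (p ≤ᴾ q)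

⟦0ᴾ⟧ : ∀ {k} (ρ : Vec ℕ k) → ⟦ 0ᴾ ⟧ᴾ ρ ≡ 0
⟦0ᴾ⟧ []      = refl
⟦0ᴾ⟧ (x ∷ ρ) = refl

⟦constᴾ⟧ : ∀ {k} c (ρ : Vec ℕ k) → ⟦ constᴾ c ⟧ᴾ ρ ≡ c
⟦constᴾ⟧ c []      = refl
⟦constᴾ⟧ c (x ∷ ρ) = trans (cong₂ _+_ (⟦constᴾ⟧ c ρ) (ℕ.*-zeroʳ x)) (ℕ.+-identityʳ c)

⟦varᴾ⟧ : ∀ {k} (i : Fin k) ρ → ⟦ varᴾ i ⟧ᴾ ρ ≡ lookup ρ i
⟦varᴾ⟧ fzero    (x ∷ ρ) rewrite ⟦0ᴾ⟧ ρ | ⟦constᴾ⟧ 1 ρ | ℕ.*-zeroʳ x = ℕ.*-identityʳ x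
⟦varᴾ⟧ (fsuc i) (x ∷ ρ) rewrite ℕ.*-zeroʳ x = trans (ℕ.+-identityʳ _) (⟦varᴾ⟧ i ρ)

⟦+ᴾ⟧ : ∀ {k} (p q : Poly k) ρ → ⟦ p +ᴾ q ⟧ᴾ ρ ≡ ⟦ p ⟧ᴾ ρ + ⟦ q ⟧ᴾ ρ
⟦+ᴾ⟧ {zero}  a       b       []      = refl
⟦+ᴾ⟧ {suc k} []      q       (x ∷ ρ) = refl
⟦+ᴾ⟧ {suc k} (a ∷ p) []      (x ∷ ρ) = sym (ℕ.+-identityʳ _)
⟦+ᴾ⟧ {suc k} (a ∷ p) (b ∷ q) (x ∷ ρ)
  rewrite ⟦+ᴾ⟧ a b ρ | ⟦+ᴾ⟧ p q (x ∷ ρ) = interchange (⟦ a ⟧ᴾ ρ) (⟦ b ⟧ᴾ ρ) x (⟦ p ⟧ᴾ (x ∷ ρ)) (⟦ q ⟧ᴾ (x ∷ ρ))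
  where
  interchange : ∀ a b x p q → a + b + x * (p + q) ≡ a + x * p + (b + x * q)
  interchange = ℕ-Solver.solve-∀

mutual
  ⟦*ᴾ⟧ : ∀ {k} (p q : Poly k) ρ → ⟦ p *ᴾ q ⟧ᴾ ρ ≡ ⟦ p ⟧ᴾ ρ * ⟦ q ⟧ᴾ ρ
  ⟦*ᴾ⟧ {zero}  a       b []      = refl
  ⟦*ᴾ⟧ {suc k} []      q (x ∷ ρ) = refl
  ⟦*ᴾ⟧ {suc k} (a ∷ p) q (x ∷ ρ)
    rewrite ⟦+ᴾ⟧ (map (a *ᴾ_) q) (0ᴾ ∷ (p *ᴾ q)) (x ∷ ρ) | ⟦map*ᴾ⟧ a q x ρ
          | ⟦0ᴾ⟧ ρ | ⟦*ᴾ⟧ p q (x ∷ ρ) = distrib (⟦ a ⟧ᴾ ρ) x (⟦ p ⟧ᴾ (x ∷ ρ)) (⟦ q ⟧ᴾ (x ∷ ρ))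
    where
    distrib : ∀ a x p q → a * q + x * (p * q) ≡ (a + x * p) * q
    distrib = ℕ-Solver.solve-∀

  ⟦map*ᴾ⟧ : ∀ {k} (a : Poly k) q x ρ → ⟦ map (a *ᴾ_) q ⟧ᴾ (x ∷ ρ) ≡ ⟦ a ⟧ᴾ ρ * ⟦ q ⟧ᴾ (x ∷ ρ)
  ⟦map*ᴾ⟧ a []      x ρ = sym (ℕ.*-zeroʳ (⟦ a ⟧ᴾ ρ))
  ⟦map*ᴾ⟧ a (b ∷ q) x ρ rewrite ⟦*ᴾ⟧ a b ρ | ⟦map*ᴾ⟧ a q x ρ = distrib (⟦ a ⟧ᴾ ρ) (⟦ b ⟧ᴾ ρ) x (⟦ q ⟧ᴾ (x ∷ ρ))
    where
    distrib : ∀ a b x q → a * b + x * (a * q) ≡ a * (b + x * q)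
    distrib = ℕ-Solver.solve-∀

≤ᴾ-sound : ∀ {k} (p q : Poly k) → T (p ≤ᴾ q) → ∀ ρ → ⟦ p ⟧ᴾ ρ ≤ ⟦ q ⟧ᴾ ρ
≤ᴾ-sound {zero}  a       b       a≤b []      = ℕ.≤ᵇ⇒≤ a b a≤b
≤ᴾ-sound {suc k} []      q       _   (x ∷ ρ) = z≤n
≤ᴾ-sound {suc k} (a ∷ p) []      le  (x ∷ ρ) with Equivalence.to T-∧ le
... | a≤0 , p≤0 = ℕ.≤-trans
  (ℕ.+-mono-≤ (subst (⟦ a ⟧ᴾ ρ ≤_) (⟦0ᴾ⟧ ρ) (≤ᴾ-sound a 0ᴾ a≤0 ρ)) (ℕ.*-monoʳ-≤ x (≤ᴾ-sound p [] p≤0 (x ∷ ρ))))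
  (ℕ.≤-reflexive (ℕ.*-zeroʳ x))
≤ᴾ-sound {suc k} (a ∷ p) (b ∷ q) le  (x ∷ ρ) with Equivalence.to T-∧ le
... | a≤b , p≤q = ℕ.+-mono-≤ (≤ᴾ-sound a b a≤b ρ) (ℕ.*-monoʳ-≤ x (≤ᴾ-sound p q p≤q (x ∷ ρ)))

infixl 6 _⊕_
infixl 7 _⊛_

data Expr (k : ℕ) : Set where
  var     : Fin k → Expr k
  con     : ℕ → Expr k
  _⊕_ _⊛_ : Expr k → Expr k → Expr k

⟦_⟧ : ∀ {k} → Expr k → Vec ℕ k → ℕ
⟦ var i ⟧ ρ = lookup ρ i
⟦ con c ⟧ ρ = c
⟦ e ⊕ e′ ⟧ ρ = ⟦ e ⟧ ρ + ⟦ e′ ⟧ ρ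
⟦ e ⊛ e′ ⟧ ρ = ⟦ e ⟧ ρ * ⟦ e′ ⟧ ρ

normalise : ∀ {k} → Expr k → Poly k
normalise (var i)  = varᴾ i
normalise (con c)  = constᴾ c
normalise (e ⊕ e′) = normalise e +ᴾ normalise e′
normalise (e ⊛ e′) = normalise e *ᴾ normalise e′

normalise-sound : ∀ {k} (e : Expr k) ρ → ⟦ normalise e ⟧ᴾ ρ ≡ ⟦ e ⟧ ρ
normalise-sound (var i)  ρ = ⟦varᴾ⟧ i ρ
normalise-sound (con c)  ρ = ⟦constᴾ⟧ c ρ
normalise-sound (e ⊕ e′) ρ =
  trans (⟦+ᴾ⟧ (normalise e) (normalise e′) ρ) (cong₂ _+_ (normalise-sound e ρ) (normalise-sound e′ ρ))
normalise-sound (e ⊛ e′) ρ =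
  trans (⟦*ᴾ⟧ (normalise e) (normalise e′) ρ) (cong₂ _*_ (normalise-sound e ρ) (normalise-sound e′ ρ))

≤-by-coefficients : ∀ {k} (e e′ : Expr k) → T (normalise e ≤ᴾ normalise e′) → ∀ ρ → ⟦ e ⟧ ρ ≤ ⟦ e′ ⟧ ρ
≤-by-coefficients e e′ le ρ =
  subst₂ _≤_ (normalise-sound e ρ) (normalise-sound e′ ρ) (≤ᴾ-sound (normalise e) (normalise e′) le ρ)

≡-by-coefficients : ∀ {k} (e e′ : Expr k) → T (normalise e ≤ᴾ normalise e′) → T (normalise e′ ≤ᴾ normalise e) →
                    ∀ ρ → ⟦ e ⟧ ρ ≡ ⟦ e′ ⟧ ρ
≡-by-coefficients e e′ e≤e′ e′≤e ρ = ℕ.≤-antisym (≤-by-coefficients e e′ e≤e′ ρ) (≤-by-coefficients e′ e e′≤e ρ)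

-- Lets the shapes below be written once and read both in ℕ and in Expr.
record Arithmetic (A : Set) : Set where
  infixl 6 _+ᴬ_
  infixl 7 _*ᴬ_
  field
    _+ᴬ_ _*ᴬ_ : A → A → A
    #_        : ℕ → A

ℕ-arithmetic : Arithmetic ℕ
ℕ-arithmetic = record { _+ᴬ_ = _+_ ; _*ᴬ_ = _*_ ; #_ = λ k → k }

Expr-arithmetic : ∀ {k} → Arithmetic (Expr k)
Expr-arithmetic = record { _+ᴬ_ = _⊕_ ; _*ᴬ_ = _⊛_ ; #_ = con }

-- n₁ = 3 + c hubs and m = r + f n₁ leaves; r hubs carry f + 1 leaves (class true) and r′ carry f.
-- rootW is W(u), rootW + hubGap β and rootW + leafGap β are W at a hub of class β and at a leaf below
-- it, and hubW, leafW are the class-false values.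
module Shape {A : Set} (ar : Arithmetic A) (c f r r′ : A) where
  open Arithmetic ar

  hubs leaves rootW hubW leafW denominator numerator scaledDenominator scaledNumerator : A
  size hubGap leafGap branchNumerator : Bool → A

  hubs   = # 3 +ᴬ c
  leaves = r +ᴬ f *ᴬ hubs
  rootW  = hubs +ᴬ # 2 *ᴬ leaves

  size true  = # 1 +ᴬ f
  size false = f

  hubGap true  = c +ᴬ r +ᴬ f *ᴬ (# 1 +ᴬ c)
  hubGap false = # 2 +ᴬ hubGap true

  leafGap true  = # 2 +ᴬ # 2 *ᴬ c +ᴬ # 2 *ᴬ r +ᴬ f *ᴬ (# 4 +ᴬ # 2 *ᴬ c)
  leafGap false = # 2 +ᴬ leafGap true

  hubW        = rootW +ᴬ hubGap false
  leafW       = rootW +ᴬ leafGap false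
  denominator = rootW *ᴬ hubW *ᴬ leafW

  branchNumerator β = hubGap β *ᴬ leafW +ᴬ size β *ᴬ (leafGap β *ᴬ hubW)
  numerator         = r *ᴬ branchNumerator true +ᴬ r′ *ᴬ branchNumerator false

  scaledDenominator = (# 2 +ᴬ c) *ᴬ denominator
  scaledNumerator   = numerator *ᴬ (# 2 *ᴬ (# 5 +ᴬ # 2 *ᴬ c))

module Shapeℕ = Shape ℕ-arithmetic

private
  module ShapeExpr {k : ℕ} = Shape (Expr-arithmetic {k})
  open Arithmetic (Expr-arithmetic {4}) using (#_; _+ᴬ_)

  x₀ x₁ x₂ x₃ : Expr 4
  x₀ = var fzero
  x₁ = var (fsuc fzero)
  x₂ = var (fsuc (fsuc fzero))
  x₃ = var (fsuc (fsuc (fsuc fzero)))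

module _ (c f r r′ : ℕ) where
  open Shape ℕ-arithmetic c f r r′
  private
    module E = ShapeExpr x₀ x₁ x₂ x₃
    ρ : Vec ℕ 4
    ρ = c ∷ f ∷ r ∷ r′ ∷ []

  hub-identity : ∀ β → rootW + hubGap β + 2 * (2 + size β) ≡ 3 * suc leaves + 2 * hubs
  hub-identity true  = ≡-by-coefficients (E.rootW ⊕ E.hubGap true ⊕ con 2 ⊛ (con 2 ⊕ E.size true))
                                         (con 3 ⊛ (con 1 ⊕ E.leaves) ⊕ con 2 ⊛ E.hubs) _ _ ρ
  hub-identity false = ≡-by-coefficients (E.rootW ⊕ E.hubGap false ⊕ con 2 ⊛ (con 2 ⊕ E.size false))
                                         (con 3 ⊛ (con 1 ⊕ E.leaves) ⊕ con 2 ⊛ E.hubs) _ _ ρ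

  leaf-identity : ∀ β → rootW + leafGap β + 2 * (size β + 3) ≡ 4 * suc leaves + 3 * hubs
  leaf-identity true  = ≡-by-coefficients (E.rootW ⊕ E.leafGap true ⊕ con 2 ⊛ (E.size true ⊕ con 3))
                                          (con 4 ⊛ (con 1 ⊕ E.leaves) ⊕ con 3 ⊛ E.hubs) _ _ ρ
  leaf-identity false = ≡-by-coefficients (E.rootW ⊕ E.leafGap false ⊕ con 2 ⊛ (E.size false ⊕ con 3))
                                          (con 4 ⊛ (con 1 ⊕ E.leaves) ⊕ con 3 ⊛ E.hubs) _ _ ρ

-- Once one of c, r is eliminated through r + r′ = 3 + c, the difference of the two sides
-- has nonnegative coefficients, except when r′ = 0.
cross-multiplied-bound : ∀ c f r r′ → r + r′ ≡ 3 + c → 1 ≤ r′ →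
  Shapeℕ.scaledDenominator c f r r′ ≤ Shapeℕ.scaledNumerator c f r r′
cross-multiplied-bound c f r 1 r+1≡3+c _
  with refl ← ℕ.+-cancelʳ-≡ 1 r (2 + c) (trans r+1≡3+c (ℕ.+-comm 1 (2 + c))) =
  ≤-by-coefficients (ShapeExpr.scaledDenominator x₀ x₁ (# 2 +ᴬ x₀) (# 1))
                    (ShapeExpr.scaledNumerator x₀ x₁ (# 2 +ᴬ x₀) (# 1)) _ (c ∷ f ∷ 0 ∷ 0 ∷ [])
cross-multiplied-bound c f r 2 r+2≡3+c _
  with refl ← ℕ.+-cancelʳ-≡ 2 r (1 + c) (trans r+2≡3+c (ℕ.+-comm 2 (1 + c))) =
  ≤-by-coefficients (ShapeExpr.scaledDenominator x₀ x₁ (# 1 +ᴬ x₀) (# 2))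
                    (ShapeExpr.scaledNumerator x₀ x₁ (# 1 +ᴬ x₀) (# 2)) _ (c ∷ f ∷ 0 ∷ 0 ∷ [])
cross-multiplied-bound c f r (suc (suc (suc s))) r+3+s≡3+c _
  with refl ← ℕ.+-cancelˡ-≡ 3 c (r + s)
                 (trans (sym r+3+s≡3+c) (trans (ℕ.+-comm r (3 + s)) (cong (3 +_) (ℕ.+-comm s r)))) =
  ≤-by-coefficients (ShapeExpr.scaledDenominator (x₁ +ᴬ x₂) x₀ x₁ (# 3 +ᴬ x₂))
                    (ShapeExpr.scaledNumerator (x₁ +ᴬ x₂) x₀ x₁ (# 3 +ᴬ x₂)) _ (f ∷ r ∷ s ∷ 0 ∷ [])

ratio-bound : ∀ n₁ c f r r′ → n₁ ≡ 3 + c → r + r′ ≡ 3 + c → 1 ≤ r′ →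
  frac (n₁ ∸ 1) (2 * (2 * n₁ ∸ 1)) Q.≤ frac (Shapeℕ.numerator c f r r′) (Shapeℕ.denominator c f r r′)
ratio-bound _ c f r r′ refl r+r′≡3+c 1≤r′ =
  frac-≤ {2 + c} {2 * (2 * (3 + c) ∸ 1)} {Shapeℕ.numerator c f r r′} {Shapeℕ.denominator c f r r′}
         (s≤s z≤n) (s≤s z≤n)
         (subst (λ k → (2 + c) * Shapeℕ.denominator c f r r′ ≤ Shapeℕ.numerator c f r r′ * (2 * k))
                (sym 2[3+c]∸1) (cross-multiplied-bound c f r r′ r+r′≡3+c 1≤r′))
  where
  2[3+c]∸1 : 2 * (3 + c) ∸ 1 ≡ 5 + 2 * c
  2[3+c]∸1 = cong (_∸ 1) (double c)
    where
    double : ∀ c → 2 * (3 + c) ≡ 6 + 2 * c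
    double = ℕ-Solver.solve-∀

ceilDiv≤1+floorDiv : ∀ m n → 0 < n → ceilDiv m n ≤ suc (floorDiv m n)
ceilDiv≤1+floorDiv m (suc k) _ = begin
  (m + k) / suc k         ≤⟨ /-monoˡ-≤ (suc k) (ℕ.+-monoʳ-≤ m (ℕ.n≤1+n k)) ⟩
  (m + suc k) / suc k     ≡⟨ m/n≡1+[m∸n]/n (ℕ.m≤n+m (suc k) m) ⟩
  suc ((m + suc k ∸ suc k) / suc k) ≡⟨ cong (λ x → suc (x / suc k)) (ℕ.m+n∸n≡m m (suc k)) ⟩
  suc (m / suc k)         ∎
  where open ℕ.≤-Reasoning

ceilDiv-floorDiv : ∀ m n → 0 < n → ceilDiv m n ≡ floorDiv m n ⊎ ceilDiv m n ≡ suc (floorDiv m n)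
ceilDiv-floorDiv m (suc k) 0<n with ℕ.m≤n⇒m<n∨m≡n (ceilDiv≤1+floorDiv m (suc k) 0<n)
... | inj₁ ceil<1+floor = inj₁ (ℕ.≤-antisym (ℕ.m<1+n⇒m≤n ceil<1+floor) (/-monoˡ-≤ (suc k) (ℕ.m≤m+n m k)))
... | inj₂ ceil≡1+floor = inj₂ ceil≡1+floor

flips : ℕ → Bool → Bool
flips zero    b = b
flips (suc k) b = flips k (not b)

module _ {N : ℕ} (G : Graph N) where

  adj⇒≢ : ∀ {x y} → adj G x y ≡ true → x ≢ y
  adj⇒≢ {x} e refl with trans (sym (irref G x)) e
  ... | ()

  walk-length-0 : ∀ {v x} → Walk G v x 0 → v ≡ x
  walk-length-0 nil = refl

  walk-length-1 : ∀ {v x} → Walk G v x 1 → adj G v x ≡ true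
  walk-length-1 (cons e nil) = e

  walk-length-2 : ∀ {v x} → Walk G v x 2 → ∃ λ z → adj G v z ≡ true × adj G z x ≡ true
  walk-length-2 (cons e (cons e′ nil)) = _ , e , e′

  walk-side : ∀ (side : Fin N → Bool) → (∀ {x y} → adj G x y ≡ true → side y ≡ not (side x)) →
              ∀ {v x k} → Walk G v x k → side x ≡ flips k (side v)
  walk-side side bipartite nil        = refl
  walk-side side bipartite (cons {k = k} e w) = trans (walk-side side bipartite w) (cong (flips k) (bipartite e))

  dist-≥ : ∀ {dist v x L} → IsDist G dist → (∀ k → k < L → ¬ Walk G v x k) → L ≤ dist v x
  dist-≥ {dist} {v} {x} {L} (walk , _) no-short-walk with L ℕ.≤? dist v x
  ... | yes L≤dist = L≤dist
  ... | no  L≰dist = contradiction (walk v x) (no-short-walk (dist v x) (ℕ.≰⇒> L≰dist))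

  no-square : (HasCycle G → ⊥) → ∀ {a b c d} →
              adj G a b ≡ true → adj G b c ≡ true → adj G c d ≡ true → adj G d a ≡ true →
              a ≢ c → b ≢ d → ⊥
  no-square acyclic {a} {b} {c} {d} ab bc cd da a≢c b≢d =
    acyclic (d , a , 3 , cons ab (cons bc (cons cd nil)) , s≤s (s≤s z≤n) , da ,
             (adj⇒≢ ab ∷ a≢c ∷ adj⇒≢ da ∘ sym ∷ []) ∷ (adj⇒≢ bc ∷ b≢d ∷ []) ∷ (adj⇒≢ cd ∷ []) ∷ [] ∷ [])

-- The tree H(u; n₀, n₁) of the statement, with n₀ = 1 + m and n₁ = 3 + c.
module H (c m N : ℕ) (G : Graph N) (tree : IsTree G) (side : Fin N → Bool)
  (bipartite : ∀ x y → adj G x y ≡ true → side x ≢ side y)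
  (|B₀| : count (λ x → not (side x)) ≡ suc m) (|B₁| : count side ≡ 3 + c)
  (u : Fin N) (u∈B₀ : side u ≡ false) (N[u] : ∀ x → (adj G u x ≡ true) ⇔ (side x ≡ true))
  (degree : ∀ w → side w ≡ true →
    (deg G w ≡ 1 + ceilDiv m (3 + c)) ⊎ (deg G w ≡ 1 + floorDiv m (3 + c)))
  (dist : Fin N → Fin N → ℕ) (isDist : IsDist G dist) where

  adj-sym : ∀ {x y} → adj G x y ≡ true → adj G y x ≡ true
  adj-sym {x} {y} = trans (Graph.sym G y x)

  opposite-side : ∀ {x y b} → adj G x y ≡ true → side x ≡ b → side y ≡ not b
  opposite-side {x} {y} xy refl = ¬-not (bipartite x y xy ∘ sym)

  side-clash : ∀ {x b} → side x ≡ b → side x ≡ not b → ⊥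
  side-clash x∈b x∈¬b = not-¬ refl (trans (sym x∈b) x∈¬b)

  parity : ∀ {v x k b} → Walk G v x k → side v ≡ b → side x ≡ flips k b
  parity w refl = walk-side G side (λ xy → opposite-side xy refl) w

  u-adj : ∀ {x} → side x ≡ true → adj G u x ≡ true
  u-adj {x} = Equivalence.from (N[u] x)

  dist-≤ : ∀ {v x k} → Walk G v x k → dist v x ≤ k
  dist-≤ = proj₂ isDist _ _ _

  leaf : Fin N → Bool
  leaf x = not (side x) ∧ not (x == u)

  B₀-split : ∀ x → [ not (side x) ] ≡ [ x == u ] + [ leaf x ]
  B₀-split x with x ≟ u | side x in x∈b
  ... | yes refl | true  = ⊥-elim (side-clash u∈B₀ x∈b)
  ... | yes refl | false = refl
  ... | no  _    | true  = refl
  ... | no  _    | false = refl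

  leaf-count : count leaf ≡ m
  leaf-count = ℕ.suc-injective (begin
    suc (count leaf)                       ≡⟨ cong (_+ count leaf) (count-== u) ⟨
    count (_== u) + count leaf             ≡⟨ sumℕ-+ (λ x → [ x == u ]) (λ x → [ leaf x ]) ⟨
    sumℕ (λ x → [ x == u ] + [ leaf x ])   ≡⟨ sumℕ-cong B₀-split ⟨
    count (λ x → not (side x))             ≡⟨ |B₀| ⟩
    suc m                                  ∎)
    where open ≡-Reasoning

  parent : ∀ x → x ≢ u → ∃ λ p → adj G x p ≡ true
  parent x x≢u with proj₁ tree x u
  ... | zero  , w                = contradiction (walk-length-0 G w) x≢u
  ... | suc _ , cons {y = p} e _ = p , e

  parent-unique : ∀ {x p p′} → side x ≡ false → x ≢ u → adj G x p ≡ true → adj G x p′ ≡ true → p ≡ p′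
  parent-unique {x} {p} {p′} x∈B₀ x≢u xp xp′ with p ≟ p′
  ... | yes p≡p′ = p≡p′
  ... | no  p≢p′ = ⊥-elim (no-square G (proj₂ tree) (u-adj (opposite-side xp x∈B₀)) (adj-sym xp) xp′
                                      (adj-sym (u-adj (opposite-side xp′ x∈B₀))) (x≢u ∘ sym) p≢p′)

  parent-sum : ∀ {x p} → side x ≡ false → x ≢ u → adj G x p ≡ true → (h : Fin N → ℕ) →
               sumℕ (λ w → [ adj G x w ] * h w) ≡ h p
  parent-sum {x} {p} x∈B₀ x≢u xp h = trans (sumℕ-single _ p off-parent) on-parent
    where
    off-parent : ∀ w → w ≢ p → [ adj G x w ] * h w ≡ 0
    off-parent w w≢p with adj G x w in xw
    ... | true  = contradiction (parent-unique x∈B₀ x≢u xw xp) w≢p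
    ... | false = refl
    on-parent : [ adj G x p ] * h p ≡ h p
    on-parent rewrite xp = ℕ.+-identityʳ (h p)

  dist-from-u : ∀ y → dist u y ≤ [ side y ] + 2 * [ leaf y ]
  dist-from-u y with y ≟ u | side y in y∈b
  ... | yes refl | _     = ℕ.≤-trans (dist-≤ nil) z≤n
  ... | no  _    | true  = dist-≤ (cons (u-adj y∈b) nil)
  ... | no  y≢u  | false with parent y y≢u
  ...   | p , yp = dist-≤ (cons (u-adj (opposite-side yp y∈b)) (cons (adj-sym yp) nil))

  W-u-pos : 0 < W dist u
  W-u-pos = ℕ.<-≤-trans (s≤s z≤n) (begin
    3 + c               ≡⟨ |B₁| ⟨
    count side          ≤⟨ sumℕ-mono-≤ B₁-far-from-u ⟩
    W dist u            ∎)
    where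
    open ℕ.≤-Reasoning
    B₁-far-from-u : ∀ y → [ side y ] ≤ dist u y
    B₁-far-from-u y with side y in y∈b
    ... | false = z≤n
    ... | true  = dist-≥ G isDist λ where
      zero    _         w → side-clash u∈B₀ (subst (λ z → side z ≡ true) (sym (walk-length-0 G w)) y∈b)
      (suc _) (s≤s ()) _

  children : Fin N → ℕ
  children w = count (λ y → adj G w y ∧ not (y == u))

  deg-children : ∀ {w} → side w ≡ true → deg G w ≡ 1 + children w
  deg-children {w} w∈B₁ = trans (sumℕ-cong split)
    (trans (sumℕ-+ (λ y → [ y == u ]) (λ y → [ adj G w y ∧ not (y == u) ])) (cong (_+ children w) (count-== u)))
    where
    split : ∀ y → [ adj G w y ] ≡ [ y == u ] + [ adj G w y ∧ not (y == u) ]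
    split y with y ≟ u | adj G w y in wy
    ... | yes refl | true  = refl
    ... | yes refl | false = contradiction (trans (sym wy) (adj-sym (u-adj w∈B₁))) λ ()
    ... | no  _    | true  = refl
    ... | no  _    | false = refl

  f : ℕ
  f = floorDiv m (3 + c)

  children-from-deg : ∀ {w k} → side w ≡ true → deg G w ≡ suc k → children w ≡ k
  children-from-deg w∈B₁ deg≡1+k = ℕ.suc-injective (trans (sym (deg-children w∈B₁)) deg≡1+k)

  children-balanced : ∀ {w} → side w ≡ true → children w ≡ f ⊎ children w ≡ suc f
  children-balanced {w} w∈B₁ with degree w w∈B₁ | ceilDiv-floorDiv m (3 + c) (s≤s z≤n)
  ... | inj₂ deg≡1+floor | _                = inj₁ (children-from-deg w∈B₁ deg≡1+floor)
  ... | inj₁ deg≡1+ceil  | inj₁ ceil≡floor   = inj₁ (trans (children-from-deg w∈B₁ deg≡1+ceil) ceil≡floor)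
  ... | inj₁ deg≡1+ceil  | inj₂ ceil≡1+floor = inj₂ (trans (children-from-deg w∈B₁ deg≡1+ceil) ceil≡1+floor)

  big : Fin N → Bool
  big w = children w ℕ.≡ᵇ suc f

  r r′ : ℕ
  r  = count (λ w → side w ∧ big w)
  r′ = count (λ w → side w ∧ not (big w))

  open Shape ℕ-arithmetic c f r r′ public

  children-size : ∀ {w} → side w ≡ true → children w ≡ size (big w)
  children-size {w} w∈B₁ with children w ℕ.≡ᵇ suc f in is-big | children-balanced w∈B₁
  ... | true  | _                = ℕ.≡ᵇ⇒≡ (children w) (suc f) (subst T (sym is-big) _)
  ... | false | inj₁ children≡f   = children≡f
  ... | false | inj₂ children≡1+f = ⊥-elim (subst T is-big (ℕ.≡⇒≡ᵇ (children w) (suc f) children≡1+f))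

  on-B₁ : ∀ {F F′ : Fin N → ℕ} → (∀ {w} → side w ≡ true → F w ≡ F′ w) →
          ∀ w → [ side w ] * F w ≡ [ side w ] * F′ w
  on-B₁ F≡F′ w with side w in w∈b
  ... | true  = cong (1 *_) (F≡F′ w∈b)
  ... | false = refl

  class-split : ∀ (F : Bool → ℕ) → sumℕ (λ w → [ side w ] * F (big w)) ≡ r * F true + r′ * F false
  class-split F = begin
    sumℕ (λ w → [ side w ] * F (big w))
      ≡⟨ sumℕ-cong split ⟩
    sumℕ (λ w → [ side w ∧ big w ] * F true + [ side w ∧ not (big w) ] * F false)
      ≡⟨ sumℕ-+ (λ w → [ side w ∧ big w ] * F true) (λ w → [ side w ∧ not (big w) ] * F false) ⟩
    sumℕ (λ w → [ side w ∧ big w ] * F true) + sumℕ (λ w → [ side w ∧ not (big w) ] * F false)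
      ≡⟨ cong₂ _+_ (sumℕ-*ʳ (F true) (λ w → [ side w ∧ big w ]))
                   (sumℕ-*ʳ (F false) (λ w → [ side w ∧ not (big w) ])) ⟩
    r * F true + r′ * F false
      ∎
    where
    open ≡-Reasoning
    split : ∀ w → [ side w ] * F (big w) ≡ [ side w ∧ big w ] * F true + [ side w ∧ not (big w) ] * F false
    split w with side w | big w
    ... | false | _     = refl
    ... | true  | true  = sym (ℕ.+-identityʳ _)
    ... | true  | false = refl

  r+r′ : r + r′ ≡ 3 + c
  r+r′ = begin
    r + r′                          ≡⟨ cong₂ _+_ (ℕ.*-identityʳ r) (ℕ.*-identityʳ r′) ⟨
    r * 1 + r′ * 1                  ≡⟨ class-split (λ _ → 1) ⟨
    sumℕ (λ w → [ side w ] * 1)     ≡⟨ sumℕ-cong (λ w → ℕ.*-identityʳ [ side w ]) ⟩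
    count side                      ≡⟨ |B₁| ⟩
    3 + c                           ∎
    where open ≡-Reasoning

  leaf-adj : ∀ x w → [ leaf x ] * [ adj G x w ] ≡ [ side w ] * [ adj G w x ∧ not (x == u) ]
  leaf-adj x w rewrite Graph.sym G w x with adj G x w in xw | side x in x∈b | x ≟ u
  ... | false | b     | x≟u      = trans (ℕ.*-zeroʳ [ not b ∧ not (does x≟u) ]) (sym (ℕ.*-zeroʳ [ side w ]))
  ... | true  | true  | _        rewrite opposite-side xw x∈b = refl
  ... | true  | false | yes refl = sym (ℕ.*-zeroʳ [ side w ])
  ... | true  | false | no  _    rewrite opposite-side xw x∈b = refl

  leaf-sum : ∀ (h : Fin N → ℕ) → sumℕ (λ x → [ leaf x ] * sumℕ (λ w → [ adj G x w ] * h w))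
                                 ≡ sumℕ (λ w → [ side w ] * (children w * h w))
  leaf-sum h = begin
    sumℕ (λ x → [ leaf x ] * sumℕ (λ w → [ adj G x w ] * h w))
      ≡⟨ sumℕ-cong (λ x → sumℕ-*ˡ [ leaf x ] (λ w → [ adj G x w ] * h w)) ⟨
    sumℕ (λ x → sumℕ (λ w → [ leaf x ] * ([ adj G x w ] * h w)))
      ≡⟨ sumℕ-comm (λ x w → [ leaf x ] * ([ adj G x w ] * h w)) ⟩
    sumℕ (λ w → sumℕ (λ x → [ leaf x ] * ([ adj G x w ] * h w)))
      ≡⟨ sumℕ-cong branch ⟩
    sumℕ (λ w → [ side w ] * (children w * h w))
      ∎
    where
    open ≡-Reasoning
    branch : ∀ w → sumℕ (λ x → [ leaf x ] * ([ adj G x w ] * h w)) ≡ [ side w ] * (children w * h w)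
    branch w = begin
      sumℕ (λ x → [ leaf x ] * ([ adj G x w ] * h w))
        ≡⟨ sumℕ-cong (λ x → trans (sym (ℕ.*-assoc [ leaf x ] _ (h w))) (cong (_* h w) (leaf-adj x w))) ⟩
      sumℕ (λ x → [ side w ] * [ adj G w x ∧ not (x == u) ] * h w)
        ≡⟨ sumℕ-*ʳ (h w) (λ x → [ side w ] * [ adj G w x ∧ not (x == u) ]) ⟩
      sumℕ (λ x → [ side w ] * [ adj G w x ∧ not (x == u) ]) * h w
        ≡⟨ cong (_* h w) (sumℕ-*ˡ [ side w ] (λ x → [ adj G w x ∧ not (x == u) ])) ⟩
      [ side w ] * children w * h w
        ≡⟨ ℕ.*-assoc [ side w ] (children w) (h w) ⟩
      [ side w ] * (children w * h w)
        ∎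

  m≡leaves : m ≡ leaves
  m≡leaves = begin
    m                                                            ≡⟨ leaf-count ⟨
    count leaf                                                   ≡⟨ sumℕ-cong one-parent ⟩
    sumℕ (λ x → [ leaf x ] * sumℕ (λ w → [ adj G x w ] * 1))     ≡⟨ leaf-sum (λ _ → 1) ⟩
    sumℕ (λ w → [ side w ] * (children w * 1))
      ≡⟨ sumℕ-cong (on-B₁ λ w∈B₁ → trans (ℕ.*-identityʳ _) (children-size w∈B₁)) ⟩
    sumℕ (λ w → [ side w ] * size (big w))                       ≡⟨ class-split size ⟩
    r * suc f + r′ * f                                           ≡⟨ regroup r r′ f ⟩
    r + f * (r + r′)                                             ≡⟨ cong (λ n → r + f * n) r+r′ ⟩
    r + f * (3 + c)                                              ∎
    where
    open ≡-Reasoning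
    one-parent : ∀ x → [ leaf x ] ≡ [ leaf x ] * sumℕ (λ w → [ adj G x w ] * 1)
    one-parent x with side x in x∈b | x ≟ u
    ... | true  | _        = refl
    ... | false | yes _    = refl
    ... | false | no  x≢u with parent x x≢u
    ...   | p , xp = sym (trans (ℕ.+-identityʳ _) (parent-sum x∈b x≢u xp (λ _ → 1)))
    regroup : ∀ r r′ f → r * suc f + r′ * f ≡ r + f * (r + r′)
    regroup = ℕ-Solver.solve-∀

  -- If every hub carried f + 1 leaves, then m = (f + 1) n₁ would give ⌊m / n₁⌋ = f + 1.
  some-hub-small : 1 ≤ r′
  some-hub-small = ℕ.n≢0⇒n>0 λ r′≡0 → ℕ.1+n≢n (sym (f≡1+f r′≡0))
    where
    f≡1+f : r′ ≡ 0 → f ≡ suc f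
    f≡1+f r′≡0 =
      trans (cong (_/ (3 + c)) (trans m≡leaves (cong (_+ f * (3 + c)) r≡3+c))) (m*n/n≡m (suc f) (3 + c))
      where
      r≡3+c : r ≡ 3 + c
      r≡3+c = trans (sym (ℕ.+-identityʳ r)) (trans (cong (r +_) (sym r′≡0)) r+r′)

  W-u-≤ : W dist u ≤ rootW
  W-u-≤ = begin
    W dist u                                   ≤⟨ sumℕ-mono-≤ dist-from-u ⟩
    sumℕ (λ y → [ side y ] + 2 * [ leaf y ])   ≡⟨ sumℕ-linear (λ y → [ side y ]) (λ y → [ leaf y ]) 2 ⟩
    count side + 2 * count leaf                ≡⟨ cong₂ (λ a b → a + 2 * b) |B₁| (trans leaf-count m≡leaves) ⟩
    rootW                                      ∎
    where open ℕ.≤-Reasoning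

  hub-profile : Fin N → Fin N → ℕ
  hub-profile x y = if y == x then 0 else if adj G x y then 1 else if side y then 2 else 3

  hub-profile-≤-dist : ∀ {x} → side x ≡ true → ∀ y → hub-profile x y ≤ dist x y
  hub-profile-≤-dist {x} x∈B₁ y with y ≟ x
  ... | yes _   = z≤n
  ... | no  y≢x with adj G x y in xy
  ...   | true  = dist-≥ G isDist λ where
          zero    _        w → y≢x (sym (walk-length-0 G w))
          (suc _) (s≤s ()) _
  ...   | false with side y in y∈b
  ...     | true  = dist-≥ G isDist λ where
            zero          _              w → y≢x (sym (walk-length-0 G w))
            (suc zero)    _              w → contradiction (trans (sym xy) (walk-length-1 G w)) λ ()
            (suc (suc _)) (s≤s (s≤s ())) _
  ...     | false = dist-≥ G isDist λ where
            zero                _                    w → y≢x (sym (walk-length-0 G w))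
            (suc zero)          _                    w → contradiction (trans (sym xy) (walk-length-1 G w)) λ ()
            (suc (suc zero))    _                    w → side-clash (parity w x∈B₁) y∈b
            (suc (suc (suc _))) (s≤s (s≤s (s≤s ()))) _

  hub-profile-pointwise : ∀ {x} → side x ≡ true → ∀ y →
    hub-profile x y + 2 * ([ y == x ] + [ adj G x y ]) ≡ 3 * [ not (side y) ] + 2 * [ side y ]
  hub-profile-pointwise {x} x∈B₁ y with y ≟ x | adj G x y in xy | side y in y∈b
  ... | yes refl | true  | _     = contradiction (trans (sym (irref G x)) xy) λ ()
  ... | yes refl | false | true  = refl
  ... | yes refl | false | false = ⊥-elim (side-clash x∈B₁ y∈b)
  ... | no  _    | true  | true  = ⊥-elim (side-clash y∈b (opposite-side xy x∈B₁))
  ... | no  _    | true  | false = refl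
  ... | no  _    | false | true  = refl
  ... | no  _    | false | false = refl

  hub-profile-total : ∀ {x} → side x ≡ true →
    sumℕ (hub-profile x) + 2 * (2 + size (big x)) ≡ 3 * suc m + 2 * (3 + c)
  hub-profile-total {x} x∈B₁ = begin
    sumℕ (hub-profile x) + 2 * (2 + size (big x))
      ≡⟨ cong (λ k → sumℕ (hub-profile x) + 2 * k)
              (cong₂ _+_ (count-== x) (trans (deg-children x∈B₁) (cong suc (children-size x∈B₁)))) ⟨
    sumℕ (hub-profile x) + 2 * (count (_== x) + deg G x)
      ≡⟨ cong (sumℕ (hub-profile x) +_) (cong (2 *_) (sumℕ-+ (λ y → [ y == x ]) (λ y → [ adj G x y ]))) ⟨
    sumℕ (hub-profile x) + 2 * sumℕ (λ y → [ y == x ] + [ adj G x y ])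
      ≡⟨ sumℕ-linear (hub-profile x) (λ y → [ y == x ] + [ adj G x y ]) 2 ⟨
    sumℕ (λ y → hub-profile x y + 2 * ([ y == x ] + [ adj G x y ]))
      ≡⟨ sumℕ-cong (hub-profile-pointwise x∈B₁) ⟩
    sumℕ (λ y → 3 * [ not (side y) ] + 2 * [ side y ])
      ≡⟨ sumℕ-combination 3 (λ y → [ not (side y) ]) 2 (λ y → [ side y ]) ⟩
    3 * count (λ y → not (side y)) + 2 * count side
      ≡⟨ cong₂ (λ a b → 3 * a + 2 * b) |B₀| |B₁| ⟩
    3 * suc m + 2 * (3 + c)
      ∎
    where open ≡-Reasoning

  W-hub-≥ : ∀ {x} → side x ≡ true → rootW + hubGap (big x) ≤ W dist x
  W-hub-≥ {x} x∈B₁ = ℕ.+-cancelʳ-≤ (2 * (2 + size (big x))) _ _ (begin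
    rootW + hubGap (big x) + 2 * (2 + size (big x))   ≡⟨ hub-identity c f r r′ (big x) ⟩
    3 * suc leaves + 2 * (3 + c)                     ≡⟨ cong (λ k → 3 * suc k + 2 * (3 + c)) m≡leaves ⟨
    3 * suc m + 2 * (3 + c)                          ≡⟨ hub-profile-total x∈B₁ ⟨
    sumℕ (hub-profile x) + 2 * (2 + size (big x))     ≤⟨ ℕ.+-monoˡ-≤ _ (sumℕ-mono-≤ (hub-profile-≤-dist x∈B₁)) ⟩
    W dist x + 2 * (2 + size (big x))                ∎)
    where open ℕ.≤-Reasoning

  leaf-profile : Fin N → Fin N → Fin N → ℕ
  leaf-profile x p y =
    if y == x then 0 else if y == p then 1 else if y == u then 2 else
    if side y then 3 else if adj G p y then 2 else 4

  module Leaf {x p : Fin N} (x∈B₀ : side x ≡ false) (x≢u : x ≢ u) (xp : adj G x p ≡ true) where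

    p∈B₁ : side p ≡ true
    p∈B₁ = opposite-side xp x∈B₀

    no-walk-0 : ∀ {y} → y ≢ x → ¬ Walk G x y 0
    no-walk-0 y≢x w = y≢x (sym (walk-length-0 G w))

    no-walk-1 : ∀ {y} → side y ≡ false → ¬ Walk G x y 1
    no-walk-1 y∈B₀ w = side-clash y∈B₀ (opposite-side (walk-length-1 G w) x∈B₀)

    leaf-profile-≤-dist : ∀ y → leaf-profile x p y ≤ dist x y
    leaf-profile-≤-dist y with y ≟ x
    ... | yes _   = z≤n
    ... | no  y≢x with y ≟ p
    ...   | yes _   = dist-≥ G isDist λ where
            zero    _        w → no-walk-0 y≢x w
            (suc _) (s≤s ()) _
    ...   | no  y≢p with y ≟ u
    ...     | yes refl = dist-≥ G isDist λ where
              zero          _              w → no-walk-0 y≢x w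
              (suc zero)    _              w → no-walk-1 u∈B₀ w
              (suc (suc _)) (s≤s (s≤s ())) _
    ...     | no  _ with side y in y∈b
    ...       | true = dist-≥ G isDist λ where
                zero                _                    w → no-walk-0 y≢x w
                (suc zero)          _                    w → y≢p (sym (parent-unique x∈B₀ x≢u xp (walk-length-1 G w)))
                (suc (suc zero))    _                    w → side-clash (parity w x∈B₀) y∈b
                (suc (suc (suc _))) (s≤s (s≤s (s≤s ()))) _
    ...       | false with adj G p y in py
    ...         | true  = dist-≥ G isDist λ where
                  zero          _              w → no-walk-0 y≢x w
                  (suc zero)    _              w → no-walk-1 y∈b w
                  (suc (suc _)) (s≤s (s≤s ())) _
    ...         | false = dist-≥ G isDist λ where
                  zero                      _                          w → no-walk-0 y≢x w
                  (suc zero)                _                          w → no-walk-1 y∈b w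
                  (suc (suc zero))          _                          w → no-walk-2 w
                  (suc (suc (suc zero)))    _                          w → side-clash y∈b (parity w x∈B₀)
                  (suc (suc (suc (suc _)))) (s≤s (s≤s (s≤s (s≤s ())))) _
      where
      no-walk-2 : ¬ Walk G x y 2
      no-walk-2 w with walk-length-2 G w
      ... | z , xz , zy with parent-unique x∈B₀ x≢u xp xz
      ...   | refl = contradiction (trans (sym py) zy) λ ()

    extra : Fin N → ℕ
    extra y = [ adj G p y ∧ not (y == u) ] + ([ y == p ] + ([ y == u ] + [ y == x ]))

    leaf-profile-pointwise : ∀ y → leaf-profile x p y + 2 * extra y ≡ 4 * [ not (side y) ] + 3 * [ side y ]
    leaf-profile-pointwise y with y ≟ x | y ≟ p | y ≟ u | side y in y∈b | adj G p y in py
    ... | yes refl | yes x≡p  | _        | _     | _     = contradiction x≡p (adj⇒≢ G xp)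
    ... | yes refl | no  _    | yes x≡u  | _     | _     = contradiction x≡u x≢u
    ... | yes refl | no  _    | no  _    | true  | _     = ⊥-elim (side-clash x∈B₀ y∈b)
    ... | yes refl | no  _    | no  _    | false | true  = refl
    ... | yes refl | no  _    | no  _    | false | false = contradiction (trans (sym py) (adj-sym xp)) λ ()
    ... | no  _    | yes refl | yes p≡u  | _     | _     = contradiction (sym p≡u) (adj⇒≢ G (u-adj p∈B₁))
    ... | no  _    | yes refl | no  _    | true  | true  = contradiction (trans (sym (irref G p)) py) λ ()
    ... | no  _    | yes refl | no  _    | true  | false = refl
    ... | no  _    | yes refl | no  _    | false | _     = ⊥-elim (side-clash p∈B₁ y∈b)
    ... | no  _    | no  _    | yes refl | true  | _     = ⊥-elim (side-clash u∈B₀ y∈b)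
    ... | no  _    | no  _    | yes refl | false | true  = refl
    ... | no  _    | no  _    | yes refl | false | false = contradiction (trans (sym py) (adj-sym (u-adj p∈B₁))) λ ()
    ... | no  _    | no  _    | no  _    | true  | true  = ⊥-elim (side-clash y∈b (opposite-side py p∈B₁))
    ... | no  _    | no  _    | no  _    | true  | false = refl
    ... | no  _    | no  _    | no  _    | false | true  = refl
    ... | no  _    | no  _    | no  _    | false | false = refl

    leaf-profile-total : sumℕ (leaf-profile x p) + 2 * (children p + 3) ≡ 4 * suc m + 3 * (3 + c)
    leaf-profile-total = begin
      sumℕ (leaf-profile x p) + 2 * (children p + 3)
        ≡⟨ cong (λ k → sumℕ (leaf-profile x p) + 2 * k) extra-total ⟨
      sumℕ (leaf-profile x p) + 2 * sumℕ extra
        ≡⟨ sumℕ-linear (leaf-profile x p) extra 2 ⟨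
      sumℕ (λ y → leaf-profile x p y + 2 * extra y)
        ≡⟨ sumℕ-cong leaf-profile-pointwise ⟩
      sumℕ (λ y → 4 * [ not (side y) ] + 3 * [ side y ])
        ≡⟨ sumℕ-combination 4 (λ y → [ not (side y) ]) 3 (λ y → [ side y ]) ⟩
      4 * count (λ y → not (side y)) + 3 * count side
        ≡⟨ cong₂ (λ a b → 4 * a + 3 * b) |B₀| |B₁| ⟩
      4 * suc m + 3 * (3 + c)
        ∎
      where
      open ≡-Reasoning
      extra-total : sumℕ extra ≡ children p + 3
      extra-total = begin
        sumℕ extra
          ≡⟨ sumℕ-+ (λ y → [ adj G p y ∧ not (y == u) ]) (λ y → [ y == p ] + ([ y == u ] + [ y == x ])) ⟩
        children p + sumℕ (λ y → [ y == p ] + ([ y == u ] + [ y == x ]))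
          ≡⟨ cong (children p +_) (sumℕ-+ (λ y → [ y == p ]) (λ y → [ y == u ] + [ y == x ])) ⟩
        children p + (count (_== p) + sumℕ (λ y → [ y == u ] + [ y == x ]))
          ≡⟨ cong (λ k → children p + (count (_== p) + k)) (sumℕ-+ (λ y → [ y == u ]) (λ y → [ y == x ])) ⟩
        children p + (count (_== p) + (count (_== u) + count (_== x)))
          ≡⟨ cong (children p +_) (cong₂ _+_ (count-== p) (cong₂ _+_ (count-== u) (count-== x))) ⟩
        children p + 3
          ∎

    W-leaf-≥ : rootW + leafGap (big p) ≤ W dist x
    W-leaf-≥ = ℕ.+-cancelʳ-≤ (2 * (size (big p) + 3)) _ _ (begin
      rootW + leafGap (big p) + 2 * (size (big p) + 3)   ≡⟨ leaf-identity c f r r′ (big p) ⟩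
      4 * suc leaves + 3 * (3 + c)                      ≡⟨ cong (λ k → 4 * suc k + 3 * (3 + c)) m≡leaves ⟨
      4 * suc m + 3 * (3 + c)                           ≡⟨ leaf-profile-total ⟨
      sumℕ (leaf-profile x p) + 2 * (children p + 3)     ≤⟨ ℕ.+-monoˡ-≤ _ (sumℕ-mono-≤ leaf-profile-≤-dist) ⟩
      W dist x + 2 * (children p + 3)                   ≡⟨ cong (λ k → W dist x + 2 * (k + 3)) (children-size p∈B₁) ⟩
      W dist x + 2 * (size (big p) + 3)                 ∎)
      where open ℕ.≤-Reasoning

  hubGap-≤ : ∀ β → hubGap β ≤ hubGap false
  hubGap-≤ true  = ℕ.m≤n+m (hubGap true) 2
  hubGap-≤ false = ℕ.≤-refl

  leafGap-≤ : ∀ β → leafGap β ≤ leafGap false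
  leafGap-≤ true  = ℕ.m≤n+m (leafGap true) 2
  leafGap-≤ false = ℕ.≤-refl

  numeratorAt : Fin N → ℕ
  numeratorAt x = [ side x ] * (hubGap (big x) * leafW)
                + [ leaf x ] * sumℕ (λ w → [ adj G x w ] * (leafGap (big w) * hubW))

  numeratorAt-u : numeratorAt u ≡ 0
  numeratorAt-u rewrite u∈B₀ with u ≟ u
  ... | yes _   = refl
  ... | no  u≢u = contradiction refl u≢u

  numeratorAt-hub : ∀ {x} → side x ≡ true → numeratorAt x ≡ hubGap (big x) * leafW
  numeratorAt-hub x∈B₁ rewrite x∈B₁ = trans (ℕ.+-identityʳ _) (ℕ.+-identityʳ _)

  numeratorAt-leaf : ∀ {x p} → side x ≡ false → x ≢ u → adj G x p ≡ true →
                     numeratorAt x ≡ leafGap (big p) * hubW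
  numeratorAt-leaf {x} x∈B₀ x≢u xp rewrite x∈B₀ with x ≟ u
  ... | yes x≡u = contradiction x≡u x≢u
  ... | no  _   = trans (ℕ.+-identityʳ _) (parent-sum x∈B₀ x≢u xp (λ w → leafGap (big w) * hubW))

  numeratorAt-u-≤ : frac (numeratorAt u) denominator Q.≤ closeness dist u Q.- closeness dist u
  numeratorAt-u-≤ =
    subst (λ g → frac g denominator Q.≤ closeness dist u Q.- closeness dist u) (sym numeratorAt-u)
      (Q.≤-reflexive (trans (frac-zero {denominator} (s≤s z≤n)) (sym (Q.+-inverseʳ (closeness dist u)))))

  numeratorAt-hub-≤ : ∀ {x} → side x ≡ true →
                      frac (numeratorAt x) denominator Q.≤ closeness dist u Q.- closeness dist x
  numeratorAt-hub-≤ {x} x∈B₁ =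
    subst (λ g → frac g denominator Q.≤ closeness dist u Q.- closeness dist x) (sym (numeratorAt-hub x∈B₁))
      (closeness-gap {W dist u} {W dist x} {rootW} {hubW} {denominator} (hubGap (big x)) leafW
                     W-u-pos W-u-≤ (W-hub-≥ x∈B₁) (ℕ.+-monoʳ-≤ rootW (hubGap-≤ (big x))) refl (s≤s z≤n))

  numeratorAt-leaf-≤ : ∀ {x p} → side x ≡ false → x ≢ u → adj G x p ≡ true →
                       frac (numeratorAt x) denominator Q.≤ closeness dist u Q.- closeness dist x
  numeratorAt-leaf-≤ {x} {p} x∈B₀ x≢u xp =
    subst (λ g → frac g denominator Q.≤ closeness dist u Q.- closeness dist x) (sym (numeratorAt-leaf x∈B₀ x≢u xp))
      (closeness-gap {W dist u} {W dist x} {rootW} {leafW} {denominator} (leafGap (big p)) hubW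
                     W-u-pos W-u-≤ (Leaf.W-leaf-≥ x∈B₀ x≢u xp) (ℕ.+-monoʳ-≤ rootW (leafGap-≤ (big p)))
                     (swap-last rootW hubW leafW) (s≤s z≤n))
    where
    swap-last : ∀ a b c → a * b * c ≡ a * c * b
    swap-last = ℕ-Solver.solve-∀

  -- Dispatching through an auxiliary function rather than 'with' keeps Agda from
  -- normalising the rational goal.
  numeratorAt-≤ : ∀ x → frac (numeratorAt x) denominator Q.≤ closeness dist u Q.- closeness dist x
  numeratorAt-≤ x = by-kind (x ≟ u) (side x) refl
    where
    by-kind : Dec (x ≡ u) → ∀ b → side x ≡ b →
              frac (numeratorAt x) denominator Q.≤ closeness dist u Q.- closeness dist x
    by-kind (yes x≡u) _     _    =
      subst (λ y → frac (numeratorAt y) denominator Q.≤ closeness dist u Q.- closeness dist y)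
            (sym x≡u) numeratorAt-u-≤
    by-kind (no  _)   true  x∈B₁ = numeratorAt-hub-≤ x∈B₁
    by-kind (no  x≢u) false x∈B₀ = numeratorAt-leaf-≤ x∈B₀ x≢u (proj₂ (parent x x≢u))

  sum-numeratorAt : sumℕ numeratorAt ≡ numerator
  sum-numeratorAt = begin
    sumℕ numeratorAt
      ≡⟨ sumℕ-+ hub-part leaf-part ⟩
    sumℕ hub-part + sumℕ leaf-part
      ≡⟨ cong (sumℕ hub-part +_) (leaf-sum (λ w → leafGap (big w) * hubW)) ⟩
    sumℕ hub-part + sumℕ (λ w → [ side w ] * (children w * (leafGap (big w) * hubW)))
      ≡⟨ sumℕ-+ hub-part (λ w → [ side w ] * (children w * (leafGap (big w) * hubW))) ⟨
    sumℕ (λ w → [ side w ] * (hubGap (big w) * leafW) + [ side w ] * (children w * (leafGap (big w) * hubW)))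
      ≡⟨ sumℕ-cong (λ w → ℕ.*-distribˡ-+ [ side w ] (hubGap (big w) * leafW)
                                                    (children w * (leafGap (big w) * hubW))) ⟨
    sumℕ (λ w → [ side w ] * (hubGap (big w) * leafW + children w * (leafGap (big w) * hubW)))
      ≡⟨ sumℕ-cong (on-B₁ λ {w} w∈B₁ →
           cong (λ k → hubGap (big w) * leafW + k * (leafGap (big w) * hubW)) (children-size w∈B₁)) ⟩
    sumℕ (λ w → [ side w ] * branchNumerator (big w))
      ≡⟨ class-split branchNumerator ⟩
    numerator
      ∎
    where
    open ≡-Reasoning
    hub-part leaf-part : Fin N → ℕ
    hub-part  w = [ side w ] * (hubGap (big w) * leafW)
    leaf-part x = [ leaf x ] * sumℕ (λ w → [ adj G x w ] * (leafGap (big w) * hubW))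

  C1-≥ : frac numerator denominator Q.≤ C1 dist u
  C1-≥ = begin
    frac numerator denominator                      ≡⟨ cong (λ k → frac k denominator) sum-numeratorAt ⟨
    frac (sumℕ numeratorAt) denominator             ≡⟨ sumℚ-frac {d = denominator} (s≤s z≤n) numeratorAt ⟨
    sumℚ (λ x → frac (numeratorAt x) denominator)   ≤⟨ sumℚ-mono-≤ numeratorAt-≤ ⟩
    C1 dist u                                       ∎
    where open Q.≤-Reasoning

lemma1 : (n₀ n₁ N : ℕ) → 1 ≤ n₀ → 3 ≤ n₁ →
  (G : Graph N) → IsTree G →
  (side : Fin N → Bool) →
  (∀ x y → adj G x y ≡ true → side x ≢ side y) →
  count (λ x → not (side x)) ≡ n₀ → count side ≡ n₁ →
  (u : Fin N) → side u ≡ false →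
  (∀ x → (adj G u x ≡ true) ⇔ (side x ≡ true)) →
  (∀ w → side w ≡ true →
    (deg G w ≡ 1 + ceilDiv (n₀ ∸ 1) n₁) ⊎ (deg G w ≡ 1 + floorDiv (n₀ ∸ 1) n₁)) →
  (dist : Fin N → Fin N → ℕ) → IsDist G dist →
  frac (n₁ ∸ 1) (2 * (2 * n₁ ∸ 1)) Q.≤ C1 dist u
lemma1 _ n₁ N (s≤s {n = m} z≤n) (s≤s (s≤s (s≤s {n = c} z≤n)))
       G tree side bipartite |B₀| |B₁| u u∈B₀ N[u] degree dist isDist =
  Q.≤-trans (ratio-bound n₁ c T.f T.r T.r′ refl T.r+r′ T.some-hub-small) T.C1-≥
  where
  module T = H c m N G tree side bipartite |B₀| |B₁| u u∈B₀ N[u] degree dist isDist
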